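{- Let $H$ be a $3$-hypergraph, $\pi$ a quasigraph in $H$, and $Y\subseteq X\subseteq V(H)$. Suppose $e$ is a hyperedge of $H$ with $\pi(e)=\emptyset$ that contains two distinct vertices $u,v\in Y$, and let $\rho=\pi+(uv)_e$. Then: (i) if $\pi$ is anticonnected on $X$ and $\rho$ is anticonnected on $Y$, then $\rho$ is anticonnected on $X$; (ii) if $\pi$ is connected on $X$, then so is $\rho$.
   Context: A $3$-hypergraph is a finite hypergraph all of whose hyperedges have size $2$ or $3$. A quasigraph $\pi$ in $H$ is a map assigning to each hyperedge $e$ either a $2$-element subset of $e$ or $\emptyset$; $e$ is used by $\pi$ if $\pi(e)\neq\emptyset$. For an unused hyperedge $e$ and $u,v\in e$, $\pi+(uv)_e$ is the quasigraph equal to $\pi$ except that its value on $e$ is $\{u,v\}$. $\pi^*$ denotes the graph on $V(H)$ whose edges are the pairs $\pi(e)$ for used hyperedges $e$. $\pi$ is connected on $X$ if the subgraph of $\pi^*$ induced on $X$ is connected. $\pi$ is anticonnected on $X$ if for every partition $\mathcal R$ of $X$ with at least two classes there is a hyperedge $f$ of $H$ intersecting at least two classes of $\mathcal R$ such that $\pi(f)$ is a subset of one class of $\mathcal R$ (possibly $\pi(f)=\emptyset$). -}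

module Defs where

open import Data.Nat using (ℕ)
open import Data.Fin using (Fin; _≟_)
open import Data.Fin.Subset using (Subset; _∈_; _∉_; _⊆_; ∣_∣; ⊥; ⁅_⁆; _∪_)
open import Data.Product using (Σ; ∃; ∃-syntax; _×_; _,_)
open import Data.Sum using (_⊎_)
open import Relation.Binary.PropositionalEquality using (_≡_; _≢_)
open import Relation.Nullary using (does)
open import Data.Bool using (if_then_else_)
open import Relation.Binary.Construct.Closure.ReflexiveTransitive using (Star)

-- A 3-hypergraph: vertex set Fin n, hyperedges indexed by Fin m
-- (so parallel hyperedges are allowed), each of size 2 or 3.
record Hypergraph : Set where
  field
    n    : ℕ
    m    : ℕ
    edge : Fin m → Subset n
    size : ∀ i → ∣ edge i ∣ ≡ 2 ⊎ ∣ edge i ∣ ≡ 3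
open Hypergraph public

Assignment : Hypergraph → Set
Assignment H = Fin (m H) → Subset (n H)

IsQuasigraph : (H : Hypergraph) → Assignment H → Set
IsQuasigraph H π = ∀ i → π i ⊆ edge H i × (∣ π i ∣ ≡ 2 ⊎ π i ≡ ⊥)

extend : (H : Hypergraph) → Assignment H → Fin (m H) → Fin (n H) → Fin (n H) → Assignment H
extend H π e u v j = if does (j ≟ e) then (⁅ u ⁆ ∪ ⁅ v ⁆) else π j

AdjIn : (H : Hypergraph) → Assignment H → Subset (n H) → Fin (n H) → Fin (n H) → Set
AdjIn H π X x y = x ∈ X × y ∈ X × x ≢ y × ∃[ f ] (x ∈ π f × y ∈ π f)

Connected : (H : Hypergraph) → Assignment H → Subset (n H) → Set
Connected H π X = ∀ x y → x ∈ X → y ∈ X → Star (AdjIn H π X) x y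

-- Partitions of X are represented by labellings c : V(H) → ℕ (only the
-- values on X matter; classes are the nonempty fibres on X).
-- "at least two classes": two vertices of X with different labels.
-- π is anticonnected on X if for every such partition there is a hyperedge f
-- meeting two classes with π(f) contained in a single class.
Anticonnected : (H : Hypergraph) → Assignment H → Subset (n H) → Set
Anticonnected H π X =
  (c : Fin (n H) → ℕ) →
  (∃[ x ] ∃[ y ] (x ∈ X × y ∈ X × c x ≢ c y)) →
  ∃[ f ] ( (∃[ x ] ∃[ y ] (x ∈ edge H f × y ∈ edge H f × x ∈ X × y ∈ X × c x ≢ c y))
         × (∃[ k ] (∀ z → z ∈ π f → z ∈ X × c z ≡ k)) )

module Submission where

open import Defs
open import Data.Fin using (Fin)
open import Data.Fin.Subset using (Subset; _∈_; _⊆_; ⊥)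
open import Data.Product using (_×_)
open import Relation.Binary.PropositionalEquality using (_≡_; _≢_)

open import Data.Nat using (ℕ)
import Data.Nat as ℕ
import Data.Fin as Fin
open import Data.Fin.Subset using (⁅_⁆; _∪_)
open import Data.Fin.Subset.Properties using (x∈⁅y⁆⇒x≡y; x∈p∪q⁻; ∉⊥)
open import Data.Product using (_,_; ∃-syntax)
open import Data.Sum using (_⊎_; inj₁; inj₂)
open import Relation.Binary.PropositionalEquality using (refl; subst; sym)
open import Relation.Nullary using (yes; no)
open import Relation.Nullary.Decidable using (dec-true; dec-false)
open import Relation.Binary.Construct.Closure.ReflexiveTransitive using (gmap)
open import Function using (id)
open import Data.Empty using (⊥-elim)

SeparatingEdge : (H : Hypergraph) → Assignment H → Subset (n H) → (Fin (n H) → ℕ) → Set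
SeparatingEdge H π X c =
  ∃[ f ] ( (∃[ x ] ∃[ y ] (x ∈ edge H f × y ∈ edge H f × x ∈ X × y ∈ X × c x ≢ c y))
         × (∃[ k ] (∀ z → z ∈ π f → z ∈ X × c z ≡ k)) )

module _ (H : Hypergraph) (π : Assignment H) (e : Fin (m H)) (u v : Fin (n H)) where

  extend-≡ : extend H π e u v e ≡ ⁅ u ⁆ ∪ ⁅ v ⁆
  extend-≡ rewrite dec-true (e Fin.≟ e) refl = refl

  extend-≢ : ∀ {f} → f ≢ e → extend H π e u v f ≡ π f
  extend-≢ {f} f≢e rewrite dec-false (f Fin.≟ e) f≢e = refl

  extend-⊇ : π e ≡ ⊥ → ∀ f → π f ⊆ extend H π e u v f
  extend-⊇ πe≡⊥ f {x} x∈πf with f Fin.≟ e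
  ... | yes refl = ⊥-elim (∉⊥ (subst (x ∈_) πe≡⊥ x∈πf))
  ... | no _     = x∈πf

  separatingEdge-extend : ∀ {X c} → u ∈ X → v ∈ X → c u ≡ c v →
                          SeparatingEdge H π X c → SeparatingEdge H (extend H π e u v) X c
  separatingEdge-extend {X} {c} u∈X v∈X cu≡cv (f , meets , k , inOneClass) with f Fin.≟ e
  ... | no f≢e   = f , meets , k , λ z z∈ρf → inOneClass z (subst (z ∈_) (extend-≢ f≢e) z∈ρf)
  ... | yes refl = f , meets , c u , λ z z∈ρe →
                     uvInOneClass z (x∈p∪q⁻ ⁅ u ⁆ ⁅ v ⁆ (subst (z ∈_) extend-≡ z∈ρe))
    where
    uvInOneClass : ∀ z → z ∈ ⁅ u ⁆ ⊎ z ∈ ⁅ v ⁆ → z ∈ X × c z ≡ c u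
    uvInOneClass z (inj₁ z∈u) rewrite x∈⁅y⁆⇒x≡y u z∈u = u∈X , refl
    uvInOneClass z (inj₂ z∈v) rewrite x∈⁅y⁆⇒x≡y v z∈v = v∈X , sym cu≡cv

separatingEdge-⊆ : ∀ {H π X Y c} → Y ⊆ X → SeparatingEdge H π Y c → SeparatingEdge H π X c
separatingEdge-⊆ Y⊆X (f , (x , y , x∈f , y∈f , x∈Y , y∈Y , cx≢cy) , k , inOneClass) =
  f , (x , y , x∈f , y∈f , Y⊆X x∈Y , Y⊆X y∈Y , cx≢cy) , k ,
  λ z z∈πf → let z∈Y , cz≡k = inOneClass z z∈πf in Y⊆X z∈Y , cz≡k

connected-mono : ∀ {H π ρ X} → (∀ f → π f ⊆ ρ f) → Connected H π X → Connected H ρ X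
connected-mono {H} {π} {ρ} {X} π⊆ρ conn x y x∈X y∈X = gmap id adj (conn x y x∈X y∈X)
  where
  adj : ∀ {a b} → AdjIn H π X a b → AdjIn H ρ X a b
  adj (a∈X , b∈X , a≢b , f , a∈πf , b∈πf) = a∈X , b∈X , a≢b , f , π⊆ρ f a∈πf , π⊆ρ f b∈πf

lemma4 : (H : Hypergraph) (π : Assignment H) → IsQuasigraph H π →
    (X Y : Subset (n H)) → Y ⊆ X →
    (e : Fin (m H)) → π e ≡ ⊥ →
    (u v : Fin (n H)) → u ≢ v → u ∈ edge H e → v ∈ edge H e →
    u ∈ Y → v ∈ Y →
    ((Anticonnected H π X → Anticonnected H (extend H π e u v) Y →
    Anticonnected H (extend H π e u v) X)
    × (Connected H π X → Connected H (extend H π e u v) X))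
lemma4 H π _ X Y Y⊆X e πe≡⊥ u v _ _ _ u∈Y v∈Y = anticonnected , connected
  where
  -- A labelling separating u from v already splits Y; otherwise {u,v} lies in one class.
  anticonnected : Anticonnected H π X → Anticonnected H (extend H π e u v) Y →
                  Anticonnected H (extend H π e u v) X
  anticonnected antiX antiY c twoClasses with c u ℕ.≟ c v
  ... | no cu≢cv = separatingEdge-⊆ {H} Y⊆X (antiY c (u , v , u∈Y , v∈Y , cu≢cv))
  ... | yes cu≡cv =
    separatingEdge-extend H π e u v (Y⊆X u∈Y) (Y⊆X v∈Y) cu≡cv (antiX c twoClasses)

  connected : Connected H π X → Connected H (extend H π e u v) X
  connected = connected-mono {H} (extend-⊇ H π e u v πe≡⊥)
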